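{- If $m\ge 3$ and $n\ge 5$ are integers, then the $G_{m,n}$-web graph $G_{m,n}$ satisfies $\eta_{dl}(G_{m,n}) = \left\lceil \frac{n+1}{2}\right\rceil$.
   Context: Let $C_{m,n} = P_m\,\square\, C_n$ (Cartesian product of the path on $m$ vertices and the cycle on $n$ vertices). It consists of $m$ layers isomorphic to $C_n$ (one for each vertex of $P_m$); the two $C_n$-layers corresponding to the endpoints of $P_m$ (whose vertices have degree 3) are the top layer and the bottom layer. Edges of $C_{m,n}$ projecting onto $P_m$ are radial edges; edges projecting onto $C_n$ are cycle edges. The $G_{m,n}$-web graph is obtained from the disjoint union of $C_{m,n}$ and the complete graph $K_n$ by adding a perfect matching between the $n$ vertices of the top layer of $C_{m,n}$ and the $n$ vertices of $K_n$, then subdividing each of these matching edges once, and subdividing once every cycle edge (every edge of the $C_n$-layers) of $C_{m,n}$; radial edges are not subdivided. For a graph $G$, $N(u)$ is the open neighborhood and $d_G(u)$ the degree of $u$. Given a vertex labeling $\ell: V(G)\to \mathbb{N}$ (positive integers), the $d$-lucky sum of $u$ is $d_\ell(u) = d_G(u) + \sum_{v\in N(u)}\ell(v)$; $\ell$ is a $d$-lucky labeling if $d_\ell(u)\neq d_\ell(v)$ for every edge $uv$. The $d$-lucky number $\eta_{dl}(G)$ is the least positive integer $k$ such that $G$ admits a $d$-lucky labeling $V(G)\to\{1,\dots,k\}$. -}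

module Defs where

open import Data.Nat.Base using (ℕ; zero; suc; _+_; _≤_; _<_; _≡ᵇ_)
open import Data.Bool.Base using (Bool; true; false; _∧_; _∨_; not; if_then_else_)
open import Data.Fin.Base using (Fin; toℕ)
open import Data.List.Base using (List; map; concatMap; allFin; _++_)
open import Data.Nat.ListAction using (sum)
open import Data.Product.Base using (Σ; _×_; ∃)
open import Relation.Binary.PropositionalEquality using (_≡_; _≢_)
open import Relation.Nullary.Negation using (¬_)

-- Finite simple graphs, given by a vertex type, a duplicate-free list
-- enumerating all vertices, and a symmetric irreflexive Boolean
-- adjacency relation.

record FinGraph : Set₁ where
  field
    V     : Set
    verts : List V
    adj   : V → V → Bool

module _ (G : FinGraph) where
  open FinGraph G

  degree : V → ℕ
  degree u = sum (map (λ v → if adj u v then 1 else 0) verts)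

  dLuckySum : (V → ℕ) → V → ℕ
  dLuckySum ℓ u = degree u + sum (map (λ v → if adj u v then ℓ v else 0) verts)

  LabelsIn : ℕ → (V → ℕ) → Set
  LabelsIn k ℓ = ∀ v → 1 ≤ ℓ v × ℓ v ≤ k

  IsDLucky : (V → ℕ) → Set
  IsDLucky ℓ = ∀ u v → adj u v ≡ true → dLuckySum ℓ u ≢ dLuckySum ℓ v

  HasDLuckyLabeling : ℕ → Set
  HasDLuckyLabeling k = Σ (V → ℕ) λ ℓ → LabelsIn k ℓ × IsDLucky ℓ

  DLuckyNumberIs : ℕ → Set
  DLuckyNumberIs k =
    1 ≤ k × HasDLuckyLabeling k × (∀ k′ → 1 ≤ k′ → k′ < k → ¬ HasDLuckyLabeling k′)

-- The G_{m,n}-web graph.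
-- Layers of C_{m,n} = P_m □ C_n are indexed by i : Fin m along the path;
-- layer 0 is the top layer (attached to K_n), layer m-1 the bottom layer.

data WebV (m n : ℕ) : Set where
  grid : Fin m → Fin n → WebV m n
  sub  : Fin m → Fin n → WebV m n   -- subdivision vertex of cycle edge (i,j)–(i,j+1 mod n)
  mid  : Fin n → WebV m n           -- subdivision vertex of matching edge (0,j)–k_j
  kv   : Fin n → WebV m n

_=ᶠ_ : ∀ {n} → Fin n → Fin n → Bool
a =ᶠ b = toℕ a ≡ᵇ toℕ b

nextᶜ : ∀ n → Fin n → Fin n → Bool
nextᶜ n a b = (suc (toℕ a) ≡ᵇ toℕ b) ∨ ((suc (toℕ a) ≡ᵇ n) ∧ (toℕ b ≡ᵇ 0))

pathAdj : ∀ {m} → Fin m → Fin m → Bool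
pathAdj a b = (suc (toℕ a) ≡ᵇ toℕ b) ∨ (suc (toℕ b) ≡ᵇ toℕ a)

webAdj : ∀ m n → WebV m n → WebV m n → Bool
-- radial edges (not subdivided)
webAdj m n (grid i j) (grid i′ j′) = (j =ᶠ j′) ∧ pathAdj i i′
-- subdivided cycle edges: (i,j) – sub i j – (i,j+1)
webAdj m n (grid i j) (sub i′ j′) = (i =ᶠ i′) ∧ ((j =ᶠ j′) ∨ nextᶜ n j′ j)
webAdj m n (sub i j) (grid i′ j′) = (i =ᶠ i′) ∧ ((j =ᶠ j′) ∨ nextᶜ n j j′)
-- subdivided matching edges: (0,j) – mid j – k_j
webAdj m n (grid i j) (mid j′) = (toℕ i ≡ᵇ 0) ∧ (j =ᶠ j′)
webAdj m n (mid j) (grid i′ j′) = (toℕ i′ ≡ᵇ 0) ∧ (j =ᶠ j′)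
webAdj m n (mid j) (kv j′) = j =ᶠ j′
webAdj m n (kv j) (mid j′) = j =ᶠ j′
webAdj m n (kv j) (kv j′) = not (j =ᶠ j′)
webAdj m n _ _ = false

webVerts : ∀ m n → List (WebV m n)
webVerts m n =
  concatMap (λ i → map (grid i) (allFin n)) (allFin m)
  ++ concatMap (λ i → map (sub i) (allFin n)) (allFin m)
  ++ map mid (allFin n)
  ++ map kv (allFin n)

WebGraph : ℕ → ℕ → FinGraph
WebGraph m n = record { V = WebV m n ; verts = webVerts m n ; adj = webAdj m n }

module Submission where

-- Everything rests on one identity for the vertices k_j of K_n.  Each k_j
-- is adjacent to all other k_j′ and to the subdivision vertex mid j, so for
-- any labeling ℓ
--     d_ℓ(k_j) + ℓ(k_j) = n + ℓ(mid j) + Σ_j′ ℓ(k_j′).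
-- Lower bound: if all labels lie in {1,…,k} with 2k ≤ n, the n values
-- d_ℓ(k_j) lie in a window of 2k − 1 < n integers, so by pigeonhole two
-- adjacent vertices k_j, k_j′ receive the same sum.
-- Upper bound: with k = ⌊n/2⌋ + 1 we label k_j by 1 + (⌊n/2⌋ ∸ j) and mid j
-- by 1 + (j ∸ ⌊n/2⌋), making d_ℓ(k_j) strictly increasing in j; the grid
-- vertices get 1 and the subdivision vertices of layer t get k (top layer),
-- 1 (bottom layer) or alternately 2, 1 (inner layers), which separates the
-- sums along radial edges.  The remaining adjacent pairs are separated by
-- size.

open import Defs
open import Data.Nat.Base
  using (ℕ; zero; suc; _+_; _*_; _∸_; _≤_; _<_; _≡ᵇ_; z≤n; s≤s; ⌊_/2⌋; ⌈_/2⌉)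
open import Data.Nat.Properties
open import Data.Nat.Tactic.RingSolver using (solve-∀)
open import Data.Nat.ListAction using (sum)
open import Data.Nat.ListAction.Properties using (sum-++)
open import Data.Bool.Base using (Bool; true; false; _∧_; _∨_; not; if_then_else_)
open import Data.Bool.Properties using (T-≡; ¬-not; ∧-identityʳ; ∧-zeroʳ; ∨-identityʳ)
open import Data.Fin.Base using (Fin; zero; suc; toℕ; fromℕ<) renaming (_<_ to _<ᶠ_)
open import Data.Fin.Properties using (toℕ<n; toℕ-fromℕ<; pigeonhole)
open import Data.List.Base using (List; []; _∷_; map; concatMap; allFin; tabulate; _++_)
open import Data.List.Properties using (map-++; map-∘; map-tabulate)
open import Data.Product.Base using (_×_; _,_; proj₁; proj₂; ∃₂)
open import Data.Sum.Base using (_⊎_; inj₁; inj₂)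
open import Function.Base using (_∘_; id)
open import Function.Bundles using (Equivalence)
open import Relation.Binary.PropositionalEquality
open import Relation.Nullary.Decidable using (yes; no)
open import Relation.Nullary.Negation using (¬_; contradiction)
open import Algebra.Properties.Semiring.Sum +-*-semiring
  using (sum-syntax; sum-cong-≗; sum-replicate-zero; ∑-distrib-+; *-distribˡ-sum)

open ≡-Reasoning

sum-allFin : ∀ n (f : Fin n → ℕ) → sum (map f (allFin n)) ≡ ∑[ j < n ] f j
sum-allFin n f = trans (cong sum (map-tabulate id f)) (sum-tabulate n f)
  where
  sum-tabulate : ∀ n (g : Fin n → ℕ) → sum (tabulate g) ≡ ∑[ j < n ] g j
  sum-tabulate zero    g = refl
  sum-tabulate (suc n) g = cong (g zero +_) (sum-tabulate n (g ∘ suc))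

∑-zero : ∀ n {f : Fin n → ℕ} → (∀ j → f j ≡ 0) → ∑[ j < n ] f j ≡ 0
∑-zero n f≗0 = trans (sum-cong-≗ f≗0) (sum-replicate-zero n)

∑-one : ∀ n → ∑[ j < n ] 1 ≡ n
∑-one zero    = refl
∑-one (suc n) = cong suc (∑-one n)

∑-mono : ∀ n {f g : Fin n → ℕ} → (∀ j → f j ≤ g j) → ∑[ j < n ] f j ≤ ∑[ j < n ] g j
∑-mono zero    f≤g = z≤n
∑-mono (suc n) f≤g = +-mono-≤ (f≤g zero) (∑-mono n (f≤g ∘ suc))

∑-δ : ∀ n (j : Fin n) (g : Fin n → ℕ) →
  ∑[ j′ < n ] (if j =ᶠ j′ then g j′ else 0) ≡ g j
∑-δ (suc n) zero    g = trans (cong (g zero +_) (∑-zero n (λ _ → refl))) (+-identityʳ _)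
∑-δ (suc n) (suc j) g = ∑-δ n j (g ∘ suc)

∑-all-but : ∀ n (j : Fin n) (g : Fin n → ℕ) →
  ∑[ j′ < n ] (if not (j =ᶠ j′) then g j′ else 0) + g j ≡ ∑[ j′ < n ] g j′
∑-all-but n j g = begin
  ∑[ j′ < n ] off j′ + g j          ≡⟨ +-comm _ (g j) ⟩
  g j + ∑[ j′ < n ] off j′          ≡⟨ cong (_+ ∑[ j′ < n ] off j′) (∑-δ n j g) ⟨
  ∑[ j′ < n ] on j′ + ∑[ j′ < n ] off j′ ≡⟨ ∑-distrib-+ on off ⟨
  ∑[ j′ < n ] (on j′ + off j′)      ≡⟨ sum-cong-≗ (λ j′ → split (j =ᶠ j′) (g j′)) ⟩
  ∑[ j′ < n ] g j′                  ∎
  where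
  on off : Fin n → ℕ
  on  j′ = if j =ᶠ j′ then g j′ else 0
  off j′ = if not (j =ᶠ j′) then g j′ else 0
  split : ∀ b x → (if b then x else 0) + (if not b then x else 0) ≡ x
  split true  x = +-identityʳ x
  split false x = refl

∑-const : ∀ n (b : Fin n → Bool) (a : ℕ) →
  ∑[ j < n ] (if b j then a else 0) ≡ a * ∑[ j < n ] (if b j then 1 else 0)
∑-const n b a = trans (sum-cong-≗ (λ j → scale (b j))) (sym (*-distribˡ-sum {n} a _))
  where
  scale : ∀ c → (if c then a else 0) ≡ a * (if c then 1 else 0)
  scale true  = sym (*-identityʳ a)
  scale false = sym (*-zeroʳ a)

∑-guard : ∀ n (b : Bool) (c : Fin n → Bool) (y : Fin n → ℕ) →
  ∑[ j < n ] (if b ∧ c j then y j else 0)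
    ≡ (if b then ∑[ j < n ] (if c j then y j else 0) else 0)
∑-guard n true  c y = refl
∑-guard n false c y = ∑-zero n (λ _ → refl)

≡ᵇ-sym : ∀ a b → (a ≡ᵇ b) ≡ (b ≡ᵇ a)
≡ᵇ-sym zero    zero    = refl
≡ᵇ-sym zero    (suc b) = refl
≡ᵇ-sym (suc a) zero    = refl
≡ᵇ-sym (suc a) (suc b) = ≡ᵇ-sym a b

≡ᵇ-refl : ∀ a → (a ≡ᵇ a) ≡ true
≡ᵇ-refl a = Equivalence.to T-≡ (≡⇒≡ᵇ a a refl)

≡ᵇ-true : ∀ {a b} → (a ≡ᵇ b) ≡ true → a ≡ b
≡ᵇ-true {a} {b} e = ≡ᵇ⇒≡ a b (Equivalence.from T-≡ e)

≡ᵇ-false : ∀ {a b} → a ≢ b → (a ≡ᵇ b) ≡ false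
≡ᵇ-false a≢b = ¬-not (a≢b ∘ ≡ᵇ-true)

count : ℕ → (ℕ → Bool) → ℕ
count n P = ∑[ x < n ] (if P (toℕ x) then 1 else 0)

count-cong : ∀ n {P Q : ℕ → Bool} → (∀ x → x < n → P x ≡ Q x) → count n P ≡ count n Q
count-cong n P≗Q = sum-cong-≗ (λ x → cong (λ b → if b then 1 else 0) (P≗Q (toℕ x) (toℕ<n x)))

count-in : ∀ n p → p < n → count n (λ x → x ≡ᵇ p) ≡ 1
count-in (suc n) zero    _         = cong suc (∑-zero n (λ _ → refl))
count-in (suc n) (suc p) (s≤s p<n) = count-in n p p<n

count-∨ : ∀ n (P Q : ℕ → Bool) → (∀ x → P x ∧ Q x ≡ false) →
  count n (λ x → P x ∨ Q x) ≡ count n P + count n Q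
count-∨ n P Q disjoint =
  trans (sum-cong-≗ {n} (λ x → split (P (toℕ x)) (Q (toℕ x)) (disjoint (toℕ x)))) (∑-distrib-+ {n} _ _)
  where
  split : ∀ b c → b ∧ c ≡ false →
    (if b ∨ c then 1 else 0) ≡ (if b then 1 else 0) + (if c then 1 else 0)
  split true  false _ = refl
  split false c     _ = refl

count-pair : ∀ n a b → a ≢ b →
  count n (λ x → (x ≡ᵇ a) ∨ (x ≡ᵇ b)) ≡ count n (λ x → x ≡ᵇ a) + count n (λ x → x ≡ᵇ b)
count-pair n a b a≢b = count-∨ n (λ x → x ≡ᵇ a) (λ x → x ≡ᵇ b) disjoint
  where
  disjoint : ∀ x → (x ≡ᵇ a) ∧ (x ≡ᵇ b) ≡ false
  disjoint x with x ≡ᵇ a in x≡ᵇa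
  ... | false = refl
  ... | true  = subst (λ y → (y ≡ᵇ b) ≡ false) (sym (≡ᵇ-true {x} {a} x≡ᵇa)) (≡ᵇ-false {a} {b} a≢b)

count-two : ∀ n a b → a ≢ b → a < n → b < n → count n (λ x → (x ≡ᵇ a) ∨ (x ≡ᵇ b)) ≡ 2
count-two n a b a≢b a<n b<n =
  trans (count-pair n a b a≢b) (cong₂ _+_ (count-in n a a<n) (count-in n b b<n))

cyclicSucc : ℕ → ℕ → ℕ → Bool
cyclicSucc n x y = (suc x ≡ᵇ y) ∨ ((suc x ≡ᵇ n) ∧ (y ≡ᵇ 0))

-- On C_n with n ≥ 2, a position t and its cyclic predecessor are two
-- positions: they index the two subdivision vertices next to a grid vertex.
count-with-pred : ∀ n t → 2 ≤ n → t < n → count n (λ x → (t ≡ᵇ x) ∨ cyclicSucc n x t) ≡ 2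
count-with-pred (suc n) zero 2≤n _ =
  trans (count-cong (suc n) same) (count-two (suc n) 0 n 0≢n (s≤s z≤n) ≤-refl)
  where
  same : ∀ x → x < suc n → ((0 ≡ᵇ x) ∨ ((x ≡ᵇ n) ∧ true)) ≡ ((x ≡ᵇ 0) ∨ (x ≡ᵇ n))
  same x _ = cong₂ _∨_ (≡ᵇ-sym 0 x) (∧-identityʳ (x ≡ᵇ n))
  0≢n : 0 ≢ n
  0≢n = <⇒≢ (≤-pred 2≤n)
count-with-pred n (suc t) _ t<n =
  trans (count-cong n same) (count-two n (suc t) t (≢-sym (<⇒≢ (n<1+n t))) t<n (<⇒≤ t<n))
  where
  same : ∀ x → x < n →
    ((suc t ≡ᵇ x) ∨ ((x ≡ᵇ t) ∨ ((suc x ≡ᵇ n) ∧ false))) ≡ ((x ≡ᵇ suc t) ∨ (x ≡ᵇ t))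
  same x _ rewrite ∧-zeroʳ (suc x ≡ᵇ n) | ∨-identityʳ (x ≡ᵇ t) = cong (_∨ (x ≡ᵇ t)) (≡ᵇ-sym (suc t) x)

-- Likewise t and its cyclic successor are two positions: they index the
-- two grid ends of the subdivided cycle edge sub i t.
count-with-succ : ∀ n t → 2 ≤ n → t < n → count n (λ x → (t ≡ᵇ x) ∨ cyclicSucc n t x) ≡ 2
count-with-succ n t 2≤n t<n with suc t ≟ n
... | yes refl = trans (count-cong n same) (count-two n t 0 t≢0 t<n (≤-trans (s≤s z≤n) 2≤n))
  where
  same : ∀ x → x < suc t → ((t ≡ᵇ x) ∨ cyclicSucc (suc t) t x) ≡ ((x ≡ᵇ t) ∨ (x ≡ᵇ 0))
  same x x<n rewrite ≡ᵇ-sym t x | ≡ᵇ-false {suc t} {x} (<⇒≢ x<n ∘ sym) | ≡ᵇ-refl t = refl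
  t≢0 : t ≢ 0
  t≢0 = ≢-sym (<⇒≢ (≤-pred 2≤n))
... | no 1+t≢n = trans (count-cong n same) (count-two n t (suc t) (<⇒≢ (n<1+n t)) t<n 1+t<n)
  where
  same : ∀ x → x < n → ((t ≡ᵇ x) ∨ cyclicSucc n t x) ≡ ((x ≡ᵇ t) ∨ (x ≡ᵇ suc t))
  same x _ rewrite ≡ᵇ-sym t x | ≡ᵇ-sym (suc t) x | ≡ᵇ-false 1+t≢n = cong ((x ≡ᵇ t) ∨_) (∨-identityʳ _)
  1+t<n : suc t < n
  1+t<n = ≤∧≢⇒< t<n 1+t≢n

pathDegree : ℕ → ℕ → ℕ
pathDegree m t = count m (λ x → (suc t ≡ᵇ x) ∨ (suc x ≡ᵇ t))

pathDegree-top : ∀ m → 2 ≤ m → pathDegree m 0 ≡ 1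
pathDegree-top m 2≤m =
  trans (count-cong m (λ x _ → trans (∨-identityʳ _) (≡ᵇ-sym 1 x))) (count-in m 1 2≤m)

pathDegree-inner : ∀ m t → suc (suc t) < m → pathDegree m (suc t) ≡ 2
pathDegree-inner m t 2+t<m =
  trans (count-cong m (λ x _ → cong (_∨ (x ≡ᵇ t)) (≡ᵇ-sym (suc (suc t)) x)))
        (count-two m (suc (suc t)) t (≢-sym (m≢1+n+m t)) 2+t<m (<-trans (n<1+n t) (<-trans (n<1+n (suc t)) 2+t<m)))

pathDegree-bottom : ∀ m t → suc (suc t) ≡ m → pathDegree m (suc t) ≡ 1
pathDegree-bottom m t refl = trans (count-cong m same) (count-in m t (<-trans (n<1+n t) (n<1+n (suc t))))
  where
  same : ∀ x → x < m → ((suc (suc t) ≡ᵇ x) ∨ (x ≡ᵇ t)) ≡ (x ≡ᵇ t)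
  same x x<m rewrite ≡ᵇ-false {suc (suc t)} {x} (<⇒≢ x<m ∘ sym) = refl

sum-webVerts : ∀ m n (f : WebV m n → ℕ) →
  sum (map f (webVerts m n))
    ≡ ∑[ i < m ] ∑[ j < n ] f (grid i j)
      + (∑[ i < m ] ∑[ j < n ] f (sub i j)
      + (∑[ j < n ] f (mid j) + ∑[ j < n ] f (kv j)))
sum-webVerts m n f =
  trans (sum-map-++ (layers grid) _)
    (cong₂ _+_ (sum-layers grid)
      (trans (sum-map-++ (layers sub) _)
        (cong₂ _+_ (sum-layers sub)
          (trans (sum-map-++ (map mid (allFin n)) _)
            (cong₂ _+_ (sum-class mid) (sum-class kv))))))
  where
  layers : (Fin m → Fin n → WebV m n) → List (WebV m n)
  layers c = concatMap (λ i → map (c i) (allFin n)) (allFin m)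

  sum-map-++ : ∀ xs ys → sum (map f (xs ++ ys)) ≡ sum (map f xs) + sum (map f ys)
  sum-map-++ xs ys = trans (cong sum (map-++ f xs ys)) (sum-++ (map f xs) (map f ys))

  sum-class : ∀ {k} (c : Fin k → WebV m n) → sum (map f (map c (allFin k))) ≡ ∑[ j < k ] f (c j)
  sum-class {k} c = trans (cong sum (sym (map-∘ (allFin k)))) (sum-allFin k (f ∘ c))

  sum-concatMap : ∀ (is : List (Fin m)) (c : Fin m → Fin n → WebV m n) →
    sum (map f (concatMap (λ i → map (c i) (allFin n)) is))
      ≡ sum (map (λ i → ∑[ j < n ] f (c i j)) is)
  sum-concatMap []       c = refl
  sum-concatMap (i ∷ is) c =
    trans (sum-map-++ (map (c i) (allFin n)) _) (cong₂ _+_ (sum-class (c i)) (sum-concatMap is c))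

  sum-layers : ∀ c → sum (map f (layers c)) ≡ ∑[ i < m ] ∑[ j < n ] f (c i j)
  sum-layers c = trans (sum-concatMap (allFin m) c) (sum-allFin m _)

-- Σ_{v ∈ N(u)} f(v) in the web graph.  The degree of u is nbSum u (λ _ → 1),
-- so d_ℓ(u) is nbSum u (λ _ → 1) + nbSum u ℓ by definition.
nbSum : ∀ {m n} → WebV m n → (WebV m n → ℕ) → ℕ
nbSum {m} {n} u f = sum (map (λ v → if webAdj m n u v then f v else 0) (webVerts m n))

-- k_j sees mid j and every other k_j′.
nbSum-kv : ∀ m n (j : Fin n) (f : WebV m n → ℕ) →
  nbSum (kv j) f + f (kv j) ≡ f (mid j) + ∑[ j′ < n ] f (kv j′)
nbSum-kv m n j f = begin
  nbSum (kv j) f + f (kv j)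
    ≡⟨ cong (_+ f (kv j)) (sum-webVerts m n _) ⟩
  (∑[ i < m ] ∑[ j′ < n ] 0 + (∑[ i < m ] ∑[ j′ < n ] 0 + (toMid + others))) + f (kv j)
    ≡⟨ cong (λ z → (z + (z + (toMid + others))) + f (kv j)) no-grid ⟩
  (toMid + others) + f (kv j)
    ≡⟨ +-assoc toMid others (f (kv j)) ⟩
  toMid + (others + f (kv j))
    ≡⟨ cong₂ _+_ (∑-δ n j (f ∘ mid)) (∑-all-but n j (f ∘ kv)) ⟩
  f (mid j) + ∑[ j′ < n ] f (kv j′)
    ∎
  where
  toMid others : ℕ
  toMid  = ∑[ j′ < n ] (if j =ᶠ j′ then f (mid j′) else 0)
  others = ∑[ j′ < n ] (if not (j =ᶠ j′) then f (kv j′) else 0)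
  no-grid : ∑[ i < m ] ∑[ j′ < n ] 0 ≡ 0
  no-grid = ∑-zero m (λ _ → ∑-zero n (λ _ → refl))

-- Both the constant
-- labeling 1 (giving degrees) and the labeling of the upper bound are layered.
module Layered {m n : ℕ} (f : WebV m n → ℕ) (a : ℕ) (σ : Fin m → ℕ)
  (f-grid : ∀ i j → f (grid i j) ≡ a) (f-sub : ∀ i j → f (sub i j) ≡ σ i) where

  private
    if-cong : ∀ (b : Bool) {x y : ℕ} → x ≡ y → (if b then x else 0) ≡ (if b then y else 0)
    if-cong b = cong (λ z → if b then z else 0)

    no-layers : ∑[ i < m ] ∑[ j < n ] 0 ≡ 0
    no-layers = ∑-zero m (λ _ → ∑-zero n (λ _ → refl))

  -- (i , j) sees its path neighbours in column j, the two subdivision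
  -- vertices of layer i next to it, and mid j if i is the top layer.
  nbSum-grid : 2 ≤ n → ∀ i j → nbSum (grid i j) f
    ≡ a * pathDegree m (toℕ i) + (σ i * 2 + (if toℕ i ≡ᵇ 0 then f (mid j) else 0))
  nbSum-grid 2≤n i j = trans (sum-webVerts m n _)
    (cong₂ _+_ radial (cong₂ _+_ cycle (trans (cong₂ _+_ toMid (∑-zero n (λ _ → refl))) (+-identityʳ _))))
    where
    column : ∀ i′ j′ → (if (j =ᶠ j′) ∧ pathAdj i i′ then f (grid i′ j′) else 0)
                     ≡ (if j =ᶠ j′ then (if pathAdj i i′ then a else 0) else 0)
    column i′ j′ with j =ᶠ j′ | pathAdj i i′
    ... | true  | true  = f-grid i′ j′
    ... | true  | false = refl
    ... | false | _     = refl
    radial : ∑[ i′ < m ] ∑[ j′ < n ] (if (j =ᶠ j′) ∧ pathAdj i i′ then f (grid i′ j′) else 0)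
           ≡ a * pathDegree m (toℕ i)
    radial = trans (sum-cong-≗ {m} (λ i′ → trans (sum-cong-≗ {n} (column i′)) (∑-δ n j _)))
                   (∑-const m (pathAdj i) a)
    nearby : Fin n → Bool
    nearby j′ = (j =ᶠ j′) ∨ nextᶜ n j′ j
    cycle : ∑[ i′ < m ] ∑[ j′ < n ] (if (i =ᶠ i′) ∧ nearby j′ then f (sub i′ j′) else 0)
          ≡ σ i * 2
    cycle = begin
      ∑[ i′ < m ] ∑[ j′ < n ] (if (i =ᶠ i′) ∧ nearby j′ then f (sub i′ j′) else 0)
        ≡⟨ sum-cong-≗ {m} (λ i′ → ∑-guard n (i =ᶠ i′) nearby (f ∘ sub i′)) ⟩
      ∑[ i′ < m ] (if i =ᶠ i′ then ∑[ j′ < n ] (if nearby j′ then f (sub i′ j′) else 0) else 0)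
        ≡⟨ ∑-δ m i _ ⟩
      ∑[ j′ < n ] (if nearby j′ then f (sub i j′) else 0)
        ≡⟨ sum-cong-≗ {n} (λ j′ → if-cong (nearby j′) (f-sub i j′)) ⟩
      ∑[ j′ < n ] (if nearby j′ then σ i else 0)
        ≡⟨ ∑-const n nearby (σ i) ⟩
      σ i * count n (λ x → (toℕ j ≡ᵇ x) ∨ cyclicSucc n x (toℕ j))
        ≡⟨ cong (σ i *_) (count-with-pred n (toℕ j) 2≤n (toℕ<n j)) ⟩
      σ i * 2
        ∎
    toMid : ∑[ j′ < n ] (if (toℕ i ≡ᵇ 0) ∧ (j =ᶠ j′) then f (mid j′) else 0)
          ≡ (if toℕ i ≡ᵇ 0 then f (mid j) else 0)
    toMid = trans (∑-guard n (toℕ i ≡ᵇ 0) (j =ᶠ_) (f ∘ mid)) (if-cong (toℕ i ≡ᵇ 0) (∑-δ n j (f ∘ mid)))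

  -- A subdivision vertex of a cycle edge sees the two ends of that edge.
  nbSum-sub : 2 ≤ n → ∀ i j → nbSum (sub i j) f ≡ a * 2
  nbSum-sub 2≤n i j = trans (sum-webVerts m n _)
    (trans (cong₂ _+_ ends (cong₂ _+_ no-layers (cong₂ _+_ (∑-zero n (λ _ → refl)) (∑-zero n (λ _ → refl)))))
           (+-identityʳ _))
    where
    nearby : Fin n → Bool
    nearby j′ = (j =ᶠ j′) ∨ nextᶜ n j j′
    ends : ∑[ i′ < m ] ∑[ j′ < n ] (if (i =ᶠ i′) ∧ nearby j′ then f (grid i′ j′) else 0) ≡ a * 2
    ends = begin
      ∑[ i′ < m ] ∑[ j′ < n ] (if (i =ᶠ i′) ∧ nearby j′ then f (grid i′ j′) else 0)
        ≡⟨ sum-cong-≗ {m} (λ i′ → ∑-guard n (i =ᶠ i′) nearby (f ∘ grid i′)) ⟩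
      ∑[ i′ < m ] (if i =ᶠ i′ then ∑[ j′ < n ] (if nearby j′ then f (grid i′ j′) else 0) else 0)
        ≡⟨ ∑-δ m i _ ⟩
      ∑[ j′ < n ] (if nearby j′ then f (grid i j′) else 0)
        ≡⟨ sum-cong-≗ {n} (λ j′ → if-cong (nearby j′) (f-grid i j′)) ⟩
      ∑[ j′ < n ] (if nearby j′ then a else 0)
        ≡⟨ ∑-const n nearby a ⟩
      a * count n (λ x → (toℕ j ≡ᵇ x) ∨ cyclicSucc n (toℕ j) x)
        ≡⟨ cong (a *_) (count-with-succ n (toℕ j) 2≤n (toℕ<n j)) ⟩
      a * 2
        ∎

  -- mid j sees the top-layer vertex (0 , j) and k_j.
  nbSum-mid : 1 ≤ m → ∀ j → nbSum (mid j) f ≡ a + f (kv j)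
  nbSum-mid 1≤m j = trans (sum-webVerts m n _)
    (cong₂ _+_ top (cong₂ _+_ no-layers (cong₂ _+_ (∑-zero n (λ _ → refl)) (∑-δ n j (f ∘ kv)))))
    where
    top : ∑[ i′ < m ] ∑[ j′ < n ] (if (toℕ i′ ≡ᵇ 0) ∧ (j =ᶠ j′) then f (grid i′ j′) else 0) ≡ a
    top = begin
      ∑[ i′ < m ] ∑[ j′ < n ] (if (toℕ i′ ≡ᵇ 0) ∧ (j =ᶠ j′) then f (grid i′ j′) else 0)
        ≡⟨ sum-cong-≗ {m} (λ i′ → ∑-guard n (toℕ i′ ≡ᵇ 0) (j =ᶠ_) (f ∘ grid i′)) ⟩
      ∑[ i′ < m ] (if toℕ i′ ≡ᵇ 0 then ∑[ j′ < n ] (if j =ᶠ j′ then f (grid i′ j′) else 0) else 0)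
        ≡⟨ sum-cong-≗ {m} (λ i′ → if-cong (toℕ i′ ≡ᵇ 0) (trans (∑-δ n j _) (f-grid i′ j))) ⟩
      ∑[ i′ < m ] (if toℕ i′ ≡ᵇ 0 then a else 0)
        ≡⟨ ∑-const m (λ i′ → toℕ i′ ≡ᵇ 0) a ⟩
      a * count m (λ x → x ≡ᵇ 0)
        ≡⟨ cong (a *_) (count-in m 0 1≤m) ⟩
      a * 1
        ≡⟨ *-identityʳ a ⟩
      a
        ∎

-- The K_n identity: for every labeling ℓ,
--   d_ℓ(k_j) + ℓ(k_j) = n + ℓ(mid j) + Σ_j′ ℓ(k_j′),
-- so d_ℓ(k_j) depends on j only through ℓ(mid j) and ℓ(k_j).
dLuckySum-kv : ∀ m n (ℓ : WebV m n → ℕ) (j : Fin n) →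
  dLuckySum (WebGraph m n) ℓ (kv j) + ℓ (kv j) ≡ n + (ℓ (mid j) + ∑[ j′ < n ] ℓ (kv j′))
dLuckySum-kv m n ℓ j = begin
  (nbSum (kv j) one + nbSum (kv j) ℓ) + ℓ (kv j)  ≡⟨ +-assoc (nbSum (kv j) one) _ _ ⟩
  nbSum (kv j) one + (nbSum (kv j) ℓ + ℓ (kv j))  ≡⟨ cong₂ _+_ degree≡n (nbSum-kv m n j ℓ) ⟩
  n + (ℓ (mid j) + ∑[ j′ < n ] ℓ (kv j′))         ∎
  where
  one : WebV m n → ℕ
  one _ = 1
  degree≡n : nbSum (kv j) one ≡ n
  degree≡n = +-cancelʳ-≡ 1 _ n
    (trans (nbSum-kv m n j one) (trans (cong suc (∑-one n)) (+-comm 1 n)))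

-- Arithmetic form of the lower-bound argument: from d + y = n + (x + s)
-- with 1 ≤ x and y ≤ k, the value d + k is determined by the offset
-- (x ∸ 1) + (k ∸ y).
offset-form : ∀ {d x y s n k} → 1 ≤ x → y ≤ k → d + y ≡ n + (x + s) →
  d + k ≡ n + (s + suc ((x ∸ 1) + (k ∸ y)))
offset-form {d} {suc x} {y} {s} {n} {k} _ y≤k eq = begin
  d + k                      ≡⟨ cong (d +_) (m+[n∸m]≡n y≤k) ⟨
  d + (y + (k ∸ y))          ≡⟨ +-assoc d y (k ∸ y) ⟨
  (d + y) + (k ∸ y)          ≡⟨ cong (_+ (k ∸ y)) eq ⟩
  (n + (suc x + s)) + (k ∸ y) ≡⟨ rearrange n x s (k ∸ y) ⟩
  n + (s + suc (x + (k ∸ y))) ∎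
  where
  rearrange : ∀ n x s r → (n + (suc x + s)) + r ≡ n + (s + suc (x + r))
  rearrange = solve-∀

-- The offsets (ℓ(mid j) ∸ 1) + (k ∸ ℓ(k_j)) take at most
-- 2k − 1 < n values, so two vertices k_i, k_j share an offset and hence a
-- d-lucky sum, although they are adjacent in K_n.
no-lucky-labeling : ∀ m n k → 1 ≤ k → k + k ≤ n → ¬ HasDLuckyLabeling (WebGraph m n) k
no-lucky-labeling m n (suc c) _ 2k≤n (ℓ , labels , lucky) =
  lucky (kv i) (kv i′) adjacent (+-cancelʳ-≡ (suc c) _ _ (begin
    D (kv i) + suc c                    ≡⟨ sum-by-offset i ⟩
    n + (S + suc (offset i))            ≡⟨ cong (λ w → n + (S + suc w)) same-offset ⟩
    n + (S + suc (offset i′))           ≡⟨ sum-by-offset i′ ⟨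
    D (kv i′) + suc c                   ∎))
  where
  D : WebV m n → ℕ
  D = dLuckySum (WebGraph m n) ℓ
  S : ℕ
  S = ∑[ j < n ] ℓ (kv j)
  offset : Fin n → ℕ
  offset j = (ℓ (mid j) ∸ 1) + (suc c ∸ ℓ (kv j))
  sum-by-offset : ∀ j → D (kv j) + suc c ≡ n + (S + suc (offset j))
  sum-by-offset j = offset-form {s = S} {n = n} (proj₁ (labels (mid j))) (proj₂ (labels (kv j))) (dLuckySum-kv m n ℓ j)
  offset-small : ∀ j → offset j < suc (c + c)
  offset-small j = s≤s (+-mono-≤ (∸-monoˡ-≤ 1 (proj₂ (labels (mid j))))
                                 (∸-monoʳ-≤ (suc c) (proj₁ (labels (kv j)))))
  few-offsets : suc (c + c) < n
  few-offsets = ≤-trans (s≤s (≤-reflexive (sym (+-suc c c)))) 2k≤n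
  collision : ∃₂ λ j j′ → j <ᶠ j′ × fromℕ< (offset-small j) ≡ fromℕ< (offset-small j′)
  collision = pigeonhole few-offsets (λ j → fromℕ< (offset-small j))
  i i′ : Fin n
  i  = proj₁ collision
  i′ = proj₁ (proj₂ collision)
  same-offset : offset i ≡ offset i′
  same-offset = begin
    offset i                              ≡⟨ toℕ-fromℕ< (offset-small i) ⟨
    toℕ (fromℕ< (offset-small i))         ≡⟨ cong toℕ (proj₂ (proj₂ (proj₂ collision))) ⟩
    toℕ (fromℕ< (offset-small i′))        ≡⟨ toℕ-fromℕ< (offset-small i′) ⟩
    offset i′                             ∎
  adjacent : not (i =ᶠ i′) ≡ true
  adjacent rewrite ≡ᵇ-false (<⇒≢ (proj₁ (proj₂ (proj₂ collision)))) = refl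

-- ⌊n/2⌋ + ⌊n/2⌋ is n or n − 1, since ⌊n/2⌋ + ⌈n/2⌉ = n and ⌈n/2⌉ ≤ ⌊n/2⌋ + 1.
half-double-≤ : ∀ n → ⌊ n /2⌋ + ⌊ n /2⌋ ≤ n
half-double-≤ n = ≤-trans (+-monoʳ-≤ ⌊ n /2⌋ (⌊n/2⌋≤⌈n/2⌉ n)) (≤-reflexive (⌊n/2⌋+⌈n/2⌉≡n n))

half-double-≥ : ∀ n → n ≤ suc (⌊ n /2⌋ + ⌊ n /2⌋)
half-double-≥ n =
  ≤-trans (≤-reflexive (sym (⌊n/2⌋+⌈n/2⌉≡n n)))
    (≤-trans (+-monoʳ-≤ ⌊ n /2⌋ (⌊n/2⌋-mono (n≤1+n (suc n)))) (≤-reflexive (+-suc ⌊ n /2⌋ ⌊ n /2⌋)))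

-- Both (a ∸ b) + b and (b ∸ a) + a equal the maximum of a and b.
monus-balance : ∀ a b → (a ∸ b) + b ≡ (b ∸ a) + a
monus-balance zero    zero    = refl
monus-balance zero    (suc b) = sym (+-identityʳ (suc b))
monus-balance (suc a) zero    = +-identityʳ (suc a)
monus-balance (suc a) (suc b) = trans (+-suc (a ∸ b) b) (trans (cong suc (monus-balance a b)) (sym (+-suc (b ∸ a) a)))

shifted-form : ∀ {d x y s n h t} → d + y ≡ n + (x + s) → x + h ≡ y + t → d + h ≡ n + (s + t)
shifted-form {d} {x} {y} {s} {n} {h} {t} eq balance = +-cancelʳ-≡ y _ _ (begin
  (d + h) + y        ≡⟨ swap d h y ⟩
  (d + y) + h        ≡⟨ cong (_+ h) eq ⟩
  n + (x + s) + h    ≡⟨ regroup n x s h ⟩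
  n + (s + (x + h))  ≡⟨ cong (λ z → n + (s + z)) balance ⟩
  n + (s + (y + t))  ≡⟨ ungroup n s y t ⟩
  (n + (s + t)) + y  ∎)
  where
  swap : ∀ d h y → (d + h) + y ≡ (d + y) + h
  swap = solve-∀
  regroup : ∀ n x s h → n + (x + s) + h ≡ n + (s + (x + h))
  regroup = solve-∀
  ungroup : ∀ n s y t → n + (s + (y + t)) ≡ (n + (s + t)) + y
  ungroup = solve-∀

parity : ℕ → Bool
parity zero    = true
parity (suc t) = not (parity t)

innerLabel : ℕ → ℕ
innerLabel t = if parity t then 2 else 1

innerLabel-range : ∀ t → 1 ≤ innerLabel t × innerLabel t ≤ 2
innerLabel-range t with parity t
... | true  = s≤s z≤n , ≤-refl
... | false = ≤-refl , s≤s z≤n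

inner-value≢6 : ∀ t → 6 + innerLabel t * 2 ≢ 6
inner-value≢6 t with parity t
... | true  = λ ()
... | false = λ ()

inner-value-alternates : ∀ t → 6 + innerLabel t * 2 ≢ 6 + innerLabel (suc t) * 2
inner-value-alternates t with parity t
... | true  = λ ()
... | false = λ ()

∧-true-left : ∀ {a b} → a ∧ b ≡ true → a ≡ true
∧-true-left {true} _ = refl

∧-true-right : ∀ {a b} → a ∧ b ≡ true → b ≡ true
∧-true-right {true} e = e

∨-true : ∀ {a b} → a ∨ b ≡ true → a ≡ true ⊎ b ≡ true
∨-true {true}  _ = inj₁ refl
∨-true {false} e = inj₂ e

module UpperBound (m n : ℕ) (3≤m : 3 ≤ m) (5≤n : 5 ≤ n) where

  h k : ℕ
  h = ⌊ n /2⌋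
  k = suc h

  2≤m : 2 ≤ m
  2≤m = ≤-trans (n≤1+n 2) 3≤m

  2≤n : 2 ≤ n
  2≤n = ≤-trans (s≤s (s≤s z≤n)) 5≤n

  2≤h : 2 ≤ h
  2≤h = ⌊n/2⌋-mono 5≤n

  subLabel : ℕ → ℕ
  subLabel t = if t ≡ᵇ 0 then k else (if suc t ≡ᵇ m then 1 else innerLabel t)

  -- mid j and k_j: 1 + (j ∸ h) and 1 + (h ∸ j); their difference grows with j
  midLabel kvLabel : ℕ → ℕ
  midLabel t = suc (t ∸ h)
  kvLabel  t = suc (h ∸ t)

  ℓ : WebV m n → ℕ
  ℓ (grid i j) = 1
  ℓ (sub i j)  = subLabel (toℕ i)
  ℓ (mid j)    = midLabel (toℕ j)
  ℓ (kv j)     = kvLabel (toℕ j)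

  -- All labels lie in {1,…,k}; for mid j this uses j < n ≤ 2h + 1.
  labels-in-range : LabelsIn (WebGraph m n) k ℓ
  labels-in-range (grid i j) = ≤-refl , s≤s z≤n
  labels-in-range (sub i j)  = subLabel-range (toℕ i)
    where
    subLabel-range : ∀ t → 1 ≤ subLabel t × subLabel t ≤ k
    subLabel-range t with t ≡ᵇ 0 | suc t ≡ᵇ m
    ... | true  | _     = s≤s z≤n , ≤-refl
    ... | false | true  = ≤-refl , s≤s z≤n
    ... | false | false = proj₁ (innerLabel-range t) , ≤-trans (proj₂ (innerLabel-range t)) (≤-trans 2≤h (n≤1+n h))
  labels-in-range (mid j)    = s≤s z≤n , s≤s (≤-trans (∸-monoˡ-≤ h j≤h+h) (≤-reflexive (m+n∸n≡m h h)))
    where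
    j≤h+h : toℕ j ≤ h + h
    j≤h+h = ≤-pred (≤-trans (toℕ<n j) (half-double-≥ n))
  labels-in-range (kv j)     = s≤s z≤n , s≤s (m∸n≤m h (toℕ j))

  D : WebV m n → ℕ
  D = dLuckySum (WebGraph m n) ℓ

  private
    module Degree = Layered {m} {n} (λ _ → 1) 1 (λ _ → 1) (λ _ _ → refl) (λ _ _ → refl)
    module Label  = Layered ℓ 1 (subLabel ∘ toℕ) (λ _ _ → refl) (λ _ _ → refl)

  -- d-lucky sum of a grid vertex in layer t whose mid neighbour (if any) has label x
  gridSum : ℕ → ℕ → ℕ
  gridSum t x = (1 * pathDegree m t + (1 * 2 + (if t ≡ᵇ 0 then 1 else 0)))
              + (1 * pathDegree m t + (subLabel t * 2 + (if t ≡ᵇ 0 then x else 0)))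

  D-grid : ∀ i j → D (grid i j) ≡ gridSum (toℕ i) (midLabel (toℕ j))
  D-grid i j = cong₂ _+_ (Degree.nbSum-grid 2≤n i j) (Label.nbSum-grid 2≤n i j)

  D-sub : ∀ i j → D (sub i j) ≡ 4
  D-sub i j = cong₂ _+_ (Degree.nbSum-sub 2≤n i j) (Label.nbSum-sub 2≤n i j)

  D-mid : ∀ j → D (mid j) ≡ 3 + kvLabel (toℕ j)
  D-mid j = cong₂ _+_ (Degree.nbSum-mid 1≤m j) (Label.nbSum-mid 1≤m j)
    where
    1≤m : 1 ≤ m
    1≤m = ≤-trans (n≤1+n 1) 2≤m

  S : ℕ
  S = ∑[ j < n ] kvLabel (toℕ j)

  -- d_ℓ(k_j) + h = n + S + j: the sums on K_n increase strictly with j.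
  D-kv : ∀ j → D (kv j) + h ≡ n + (S + toℕ j)
  D-kv j = shifted-form {d = D (kv j)} {s = S} {n = n} (dLuckySum-kv m n ℓ j) (cong suc (monus-balance (toℕ j) h))

  data Layer : ℕ → Set where
    top    : Layer 0
    inner  : ∀ t → suc (suc t) < m → Layer (suc t)
    bottom : ∀ t → suc (suc t) ≡ m → Layer (suc t)

  layer : ∀ t → t < m → Layer t
  layer zero    _     = top
  layer (suc t) 1+t<m with m≤n⇒m<n∨m≡n 1+t<m
  ... | inj₁ 2+t<m = inner t 2+t<m
  ... | inj₂ 2+t≡m = bottom t 2+t≡m

  gridSum-top : ∀ x → gridSum 0 x ≡ 5 + (k * 2 + x)
  gridSum-top x rewrite pathDegree-top m 2≤m = refl

  gridSum-inner : ∀ t x → suc (suc t) < m → gridSum (suc t) x ≡ 6 + innerLabel (suc t) * 2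
  gridSum-inner t x 2+t<m rewrite pathDegree-inner m t 2+t<m | ≡ᵇ-false (<⇒≢ 2+t<m) =
    cong (6 +_) (+-identityʳ _)

  gridSum-bottom : ∀ t x → suc (suc t) ≡ m → gridSum (suc t) x ≡ 6
  gridSum-bottom t x 2+t≡m rewrite pathDegree-bottom m t 2+t≡m | 2+t≡m | ≡ᵇ-refl m = refl

  -- The top layer sums are at least 5 + 2k ≥ 11: larger than 3 + y for any
  -- label y, and than the sum 8 of the first inner layer.
  top-large : ∀ x → 5 + k * 2 ≤ gridSum 0 x
  top-large x rewrite gridSum-top x = +-monoʳ-≤ 5 (m≤m+n (k * 2) x)

  top-above-label : ∀ x y → y ≤ k → 3 + y < gridSum 0 x
  top-above-label x y y≤k =
    ≤-trans (≤-trans (+-monoʳ-≤ 4 (≤-trans y≤k (m≤m*n k 2))) (n≤1+n _)) (top-large x)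

  top-above-8 : ∀ x → 8 < gridSum 0 x
  top-above-8 x = ≤-trans (+-monoʳ-≤ 5 (*-monoˡ-≤ 2 {2} (≤-trans (n≤1+n 2) (s≤s 2≤h)))) (top-large x)

  -- Grid sums are at least 6, while subdivision vertices have sum 4.
  gridSum≢4 : ∀ t x → t < m → gridSum t x ≢ 4
  gridSum≢4 t x t<m with layer t t<m
  ... | top            rewrite gridSum-top x          = λ ()
  ... | inner t′ 2+t<m rewrite gridSum-inner t′ x 2+t<m = λ ()
  ... | bottom t′ 2+t≡m rewrite gridSum-bottom t′ x 2+t≡m = λ ()

  gridSum-radial : ∀ t x y → suc t < m → gridSum t x ≢ gridSum (suc t) y
  gridSum-radial t x y 1+t<m with layer t (<-trans (n<1+n t) 1+t<m) | layer (suc t) 1+t<m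
  ... | top | inner _ 2<m rewrite gridSum-inner 0 y 2<m =
    ≢-sym (<⇒≢ (top-above-8 x))
  ... | top | bottom _ 2≡m = contradiction (subst (3 ≤_) (sym 2≡m) 3≤m) λ { (s≤s (s≤s ())) }
  ... | inner t′ _ | inner _ 3+t′<m rewrite gridSum-inner t′ x (<-trans (n<1+n _) 3+t′<m)
                                          | gridSum-inner (suc t′) y 3+t′<m = inner-value-alternates (suc t′)
  ... | inner t′ 2+t′<m | bottom _ 3+t′≡m rewrite gridSum-inner t′ x 2+t′<m
                                          | gridSum-bottom (suc t′) y 3+t′≡m = inner-value≢6 (suc t′)
  ... | bottom _ 2+t′≡m | _ = contradiction 2+t′≡m (<⇒≢ 1+t<m)

  -- mid j has a small sum 3 + ℓ(k_j) ≤ 4 + h, while every k_j′ has sum at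
  -- least 2n − h > 4 + h because S ≥ n and n ≥ 5.
  mid≢kv : ∀ j j′ → D (mid j) ≢ D (kv j′)
  mid≢kv j j′ same = <⇒≢ small-side (begin
    (3 + kvLabel (toℕ j)) + h  ≡⟨ cong (_+ h) (trans (sym (D-mid j)) same) ⟩
    D (kv j′) + h              ≡⟨ D-kv j′ ⟩
    n + (S + toℕ j′)           ∎)
    where
    n≤S : n ≤ S
    n≤S = ≤-trans (≤-reflexive (sym (∑-one n))) (∑-mono n (λ _ → s≤s z≤n))
    small-side : (3 + kvLabel (toℕ j)) + h < n + (S + toℕ j′)
    small-side =
      ≤-trans (s≤s (≤-trans (+-monoˡ-≤ h (+-monoʳ-≤ 3 (s≤s (m∸n≤m h (toℕ j)))))
                            (+-monoʳ-≤ 4 (half-double-≤ n))))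
              (≤-trans (+-monoˡ-≤ n 5≤n) (+-monoʳ-≤ n (≤-trans n≤S (m≤m+n S _))))

  kv-injective : ∀ j j′ → D (kv j) ≡ D (kv j′) → toℕ j ≡ toℕ j′
  kv-injective j j′ same = +-cancelˡ-≡ S _ _ (+-cancelˡ-≡ n _ _ (begin
    n + (S + toℕ j)   ≡⟨ D-kv j ⟨
    D (kv j) + h      ≡⟨ cong (_+ h) same ⟩
    D (kv j′) + h     ≡⟨ D-kv j′ ⟩
    n + (S + toℕ j′)  ∎))

  grid≢grid : ∀ i i′ j j′ → suc (toℕ i) ≡ toℕ i′ → D (grid i j) ≢ D (grid i′ j′)
  grid≢grid i i′ j j′ below rewrite D-grid i j | D-grid i′ j′ | sym below =
    gridSum-radial (toℕ i) (midLabel (toℕ j)) (midLabel (toℕ j′)) (subst (_< m) (sym below) (toℕ<n i′))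

  grid≢sub : ∀ i j i′ j′ → D (grid i j) ≢ D (sub i′ j′)
  grid≢sub i j i′ j′ rewrite D-grid i j | D-sub i′ j′ = gridSum≢4 (toℕ i) _ (toℕ<n i)

  top≢mid : ∀ i j j′ → toℕ i ≡ 0 → D (grid i j) ≢ D (mid j′)
  top≢mid i j j′ i≡0 rewrite D-grid i j | D-mid j′ | i≡0 =
    ≢-sym (<⇒≢ (top-above-label _ _ (proj₂ (labels-in-range (kv j′)))))

  lucky : IsDLucky (WebGraph m n) ℓ
  lucky (grid i j) (grid i′ j′) adj with ∨-true (∧-true-right {j =ᶠ j′} adj)
  ... | inj₁ up   = grid≢grid i i′ j j′ (≡ᵇ-true up)
  ... | inj₂ down = ≢-sym (grid≢grid i′ i j′ j (≡ᵇ-true down))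
  lucky (grid i j) (sub i′ j′) _   = grid≢sub i j i′ j′
  lucky (sub i j)  (grid i′ j′) _  = ≢-sym (grid≢sub i′ j′ i j)
  lucky (grid i j) (mid j′) adj    = top≢mid i j j′ (≡ᵇ-true (∧-true-left adj))
  lucky (mid j)    (grid i′ j′) adj = ≢-sym (top≢mid i′ j′ j (≡ᵇ-true (∧-true-left adj)))
  lucky (mid j)    (kv j′) _       = mid≢kv j j′
  lucky (kv j)     (mid j′) _      = ≢-sym (mid≢kv j′ j)
  lucky (kv j)     (kv j′) adj     = distinct ∘ kv-injective j j′
    where
    distinct : toℕ j ≢ toℕ j′
    distinct j≡j′ = contradiction (trans (sym (cong not same-test)) adj) λ ()
      where
      same-test : (j =ᶠ j′) ≡ true
      same-test = subst (λ y → (toℕ j ≡ᵇ y) ≡ true) j≡j′ (≡ᵇ-refl (toℕ j))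
  lucky (grid i j) (kv j′)  ()
  lucky (sub i j)  (sub i′ j′) ()
  lucky (sub i j)  (mid j′) ()
  lucky (sub i j)  (kv j′)  ()
  lucky (mid j)    (sub i′ j′) ()
  lucky (mid j)    (mid j′) ()
  lucky (kv j)     (grid i′ j′) ()
  lucky (kv j)     (sub i′ j′) ()

  lucky-labeling : HasDLuckyLabeling (WebGraph m n) k
  lucky-labeling = ℓ , labels-in-range , lucky

-- The theorem: the labeling above attains ⌊n/2⌋ + 1 = ⌈(n+1)/2⌉, and
-- every smaller k′ satisfies 2k′ ≤ n, so no-lucky-labeling excludes it.
theorem3p1 : (m n : ℕ) → 3 ≤ m → 5 ≤ n →
    DLuckyNumberIs (WebGraph m n) ⌈ suc n /2⌉
theorem3p1 m n 3≤m 5≤n = s≤s z≤n , UpperBound.lucky-labeling m n 3≤m 5≤n , minimal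
  where
  minimal : ∀ k′ → 1 ≤ k′ → k′ < ⌈ suc n /2⌉ → ¬ HasDLuckyLabeling (WebGraph m n) k′
  minimal k′ 1≤k′ (s≤s k′≤h) =
    no-lucky-labeling m n k′ 1≤k′ (≤-trans (+-mono-≤ k′≤h k′≤h) (half-double-≤ n))
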